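{- Let $\mathcal{C}$ be a reaction-feedforward chemical reaction network and $\vec i$ a configuration. If some terminal configuration $\vec c_{\vec i}$ is reachable from $\vec i$, then $\vec c_{\vec i}$ is reached by every sufficiently long execution from $\vec i$, so $\vec c_{\vec i}$ is the only terminal configuration reachable from $\vec i$; furthermore, all executions from $\vec i$ to $\vec c_{\vec i}$ are permutations of one another, i.e. they use each reaction the same number of times. In particular, $\mathcal{C}$ is execution bounded from $\vec i$ (every execution from $\vec i$ is finite).
   Context: A chemical reaction network (CRN) is a pair $(\Lambda,R)$ of a finite species set $\Lambda$ and a finite set of reactions $(\vec r,\vec p)\in\mathbb{N}^\Lambda\times\mathbb{N}^\Lambda$. Configurations are $\vec c\in\mathbb{N}^\Lambda$; a reaction is applicable if $\vec r\le\vec c$ componentwise and yields $\vec c-\vec r+\vec p$. An execution is a finite or infinite sequence of configurations each obtained from the previous by one applicable reaction, consecutive ones distinct; a configuration is reachable from $\vec i$ if a finite execution leads to it from $\vec i$. A configuration is terminal if no reaction is applicable to it. A species $S$ is a reactant of $(\vec r,\vec p)$ if $\vec r(S)>0$ and appears in it if $\vec r(S)>0$ or $\vec p(S)>0$. A CRN is reaction-feedforward if its reactions can be ordered $r_1,\dots,r_n$ so that for all $k<\ell$, no reactant of $r_k$ appears (as reactant or product) in $r_\ell$. -}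

module Defs where

open import Data.Nat using (ℕ; _∸_; _+_; _≤_; _<_)
open import Data.Fin using (Fin) renaming (_<_ to _<ᶠ_)
open import Data.Fin.Permutation using (Permutation′; _⟨$⟩ʳ_)
open import Data.List using (List; []; _∷_)
open import Data.Product using (Σ; _×_; ∃)
open import Data.Sum using (_⊎_)
open import Relation.Binary.PropositionalEquality using (_≡_)
open import Relation.Nullary using (¬_)

Config : ℕ → Set
Config m = Fin m → ℕ

_≋_ : ∀ {m} → Config m → Config m → Set
c ≋ d = ∀ s → c s ≡ d s

_≤ᶜ_ : ∀ {m} → Config m → Config m → Set
c ≤ᶜ d = ∀ s → c s ≤ d s

record Reaction (m : ℕ) : Set where
  constructor _⇒_
  field
    reactants : Config m
    products  : Config m
open Reaction public

-- A CRN with m species and n reactions: the reactions are indexed by Fin n,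
-- and (being a set) the indexing must be injective, see DistinctReactions.
CRN : ℕ → ℕ → Set
CRN m n = Fin n → Reaction m

DistinctReactions : ∀ {m n} → CRN m n → Set
DistinctReactions C = ∀ j k →
  reactants (C j) ≋ reactants (C k) → products (C j) ≋ products (C k) → j ≡ k

Applicable : ∀ {m} → Reaction m → Config m → Set
Applicable ρ c = reactants ρ ≤ᶜ c

apply : ∀ {m} → Reaction m → Config m → Config m
apply ρ c s = c s ∸ reactants ρ s + products ρ s

Step : ∀ {m n} → CRN m n → Config m → Fin n → Config m → Set
Step C c j d = Applicable (C j) c × d ≋ apply (C j) c × ¬ (d ≋ c)

data Exec {m n} (C : CRN m n) : Config m → List (Fin n) → Config m → Set where
  done : ∀ {c} → Exec C c [] c
  step : ∀ {c d e j js} → Step C c j d → Exec C d js e → Exec C c (j ∷ js) e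

Reachable : ∀ {m n} → CRN m n → Config m → Config m → Set
Reachable C c d = ∃ λ js → Exec C c js d

Terminal : ∀ {m n} → CRN m n → Config m → Set
Terminal C c = ∀ j → ¬ Applicable (C j) c

InfiniteExec : ∀ {m n} → CRN m n → Config m → Set
InfiniteExec {m} C i =
  Σ (ℕ → Config m) λ f → f 0 ≋ i × (∀ t → ∃ λ j → Step C (f t) j (f (ℕ.suc t)))
  where import Data.Nat as ℕ

IsReactant : ∀ {m} → Reaction m → Fin m → Set
IsReactant ρ s = 0 < reactants ρ s

Appears : ∀ {m} → Reaction m → Fin m → Set
Appears ρ s = 0 < reactants ρ s ⊎ 0 < products ρ s

-- Reaction-feedforward: there is an ordering r_1..r_n (a permutation π of the
-- indices, r_k = C (π k)) such that for k < ℓ no reactant of r_k appears in r_ℓ.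
ReactionFeedforward : ∀ {m n} → CRN m n → Set
ReactionFeedforward {m} {n} C =
  Σ (Permutation′ n) λ π → ∀ (k ℓ : Fin n) → k <ᶠ ℓ → ∀ (s : Fin m) →
    IsReactant (C (π ⟨$⟩ʳ k)) s → ¬ Appears (C (π ⟨$⟩ʳ ℓ)) s

{-# OPTIONS --safe #-}
-- In a reaction-feedforward CRN no species is a reactant of two different
-- reactions, so once a reaction is applicable only its own firing can disable it.
-- Fix an execution es from i to a terminal c.  Along any execution from i, every
-- reaction that fires must still occur among the reactions of es not yet used:
-- otherwise none of those remaining reactions consumes its reactants, and it
-- would still be applicable at c.  So every execution from i fires a
-- sub-multiset of es; comparing lengths gives the uniqueness of c, the
-- permutation statement and the bound |es| on the length of any execution.
module Submission where

open import Defs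
open import Data.Nat using (ℕ; zero; suc; _+_; _∸_; _≤_; _<_; z≤n; s≤s)
open import Data.Nat.Properties
  using (+-assoc; +-suc; +-identityʳ; +-cancelʳ-≡; m≤m+n; m∸n+n≡m;
         ≤-trans; ≤-reflexive; ≮⇒≥; n≤0⇒n≡0; <⇒≱; +-commutativeSemigroup)
  renaming (_<?_ to _<ℕ?_)
open import Algebra.Properties.CommutativeSemigroup +-commutativeSemigroup
  using (xy∙z≈xz∙y; x∙yz≈xz∙y)
open import Data.Nat.ListAction using (sum)
open import Data.Nat.ListAction.Properties using (sum-↭)
open import Data.Fin using (Fin)
open import Data.Fin.Properties using (<-cmp; _≟_)
open import Data.Fin.Permutation using (_⟨$⟩ʳ_; _⟨$⟩ˡ_; inverseʳ)
open import Data.List using (List; []; _∷_; _++_; length; map)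
open import Data.List.Properties using (length-++; ++-identityʳ)
open import Data.List.Membership.Propositional using (_∈_; _∉_)
open import Data.List.Membership.Propositional.Properties using (∈-∃++)
open import Data.List.Relation.Unary.Any using (here; there)
open import Data.List.Relation.Binary.Permutation.Propositional
  using (_↭_; prep; ↭-refl; ↭-trans; ↭-reflexive)
open import Data.List.Relation.Binary.Permutation.Propositional.Properties
  using (shift; ↭-length; map⁺)
open import Data.Product using (_×_; ∃; _,_; proj₁)
open import Data.Sum using (inj₁)
open import Data.Empty using (⊥-elim)
open import Function using (_∘_)
open import Relation.Nullary using (¬_; yes; no)
open import Relation.Binary using (tri<; tri≈; tri>)
open import Relation.Binary.PropositionalEquality
  using (_≡_; refl; sym; trans; cong; cong₂; subst; module ≡-Reasoning)

module _ {a} {A : Set a} where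

  infix 4 _⊑_

  _⊑_ : List A → List A → Set a
  xs ⊑ ys = ∃ λ zs → ys ↭ xs ++ zs

  ∈⇒↭∷ : ∀ {x : A} {xs} → x ∈ xs → ∃ λ ys → xs ↭ x ∷ ys
  ∈⇒↭∷ {x} x∈xs with ys , zs , refl ← ∈-∃++ x∈xs = ys ++ zs , shift x ys zs

  ⊑-length : ∀ {xs ys : List A} → xs ⊑ ys → length xs ≤ length ys
  ⊑-length {xs} (zs , ys↭xs++zs) =
    ≤-trans (m≤m+n _ _) (≤-reflexive (sym (trans (↭-length ys↭xs++zs) (length-++ xs))))

  ⊑∧length≤⇒↭ : ∀ {xs ys : List A} → xs ⊑ ys → length ys ≤ length xs → ys ↭ xs
  ⊑∧length≤⇒↭ {xs} ([] , ys↭xs++[]) _ = ↭-trans ys↭xs++[] (↭-reflexive (++-identityʳ xs))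
  ⊑∧length≤⇒↭ {xs} {ys} (z ∷ zs , ys↭xs++z∷zs) ys≤xs = ⊥-elim (<⇒≱ xs<ys ys≤xs)
    where
    xs<ys : length xs < length ys
    xs<ys = ≤-trans (s≤s (m≤m+n (length xs) (length zs)))
      (≤-reflexive (sym (trans (↭-length ys↭xs++z∷zs) (trans (length-++ xs) (+-suc _ _)))))

  ⊑-antisym : ∀ {xs ys : List A} → xs ⊑ ys → ys ⊑ xs → xs ↭ ys
  ⊑-antisym xs⊑ys ys⊑xs = ⊑∧length≤⇒↭ ys⊑xs (⊑-length xs⊑ys)

module _ {m} {c d : Config m} where

  applicable-resp-≋ : ∀ {ρ} → c ≋ d → Applicable ρ c → Applicable ρ d
  applicable-resp-≋ c≋d ρ-applicable s = subst (_ ≤_) (c≋d s) (ρ-applicable s)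

  terminal-resp-≋ : ∀ {n} {C : CRN m n} → c ≋ d → Terminal C d → Terminal C c
  terminal-resp-≋ {C = C} c≋d d-terminal j = d-terminal j ∘ applicable-resp-≋ {ρ = C j} c≋d

module Executions {m n} (C : CRN m n) where

  open import Data.List.Membership.DecPropositional (_≟_ {n}) using (_∈?_)

  consumed produced : List (Fin n) → Fin m → ℕ
  consumed js s = sum (map (λ j → reactants (C j) s) js)
  produced js s = sum (map (λ j → products (C j) s) js)

  -- Firing the multiset js from c leads to d, applicability ignored; the balance
  -- is stated additively to avoid truncated subtraction.
  record Balanced (c : Config m) (js : List (Fin n)) (d : Config m) : Set where
    constructor balanced
    field balance : ∀ s → d s + consumed js s ≡ c s + produced js s

  step-balance : ∀ {c j d} → Step C c j d → ∀ s → d s + reactants (C j) s ≡ c s + products (C j) s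
  step-balance {c} {j} {d} (applicable , d≋c∸r+p , _) s = begin
    d s + r              ≡⟨ cong (_+ r) (d≋c∸r+p s) ⟩
    c s ∸ r + p + r      ≡⟨ xy∙z≈xz∙y (c s ∸ r) p r ⟩
    c s ∸ r + r + p      ≡⟨ cong (_+ p) (m∸n+n≡m (applicable s)) ⟩
    c s + p              ∎
    where
    open ≡-Reasoning
    r = reactants (C j) s
    p = products (C j) s

  private
    step-then-rest : ∀ {c j d} → Step C c j d → ∀ js s →
      d s + produced js s + reactants (C j) s ≡ c s + produced (j ∷ js) s
    step-then-rest {c} {j} {d} c→d js s = begin
      d s + P + reactants (C j) s  ≡⟨ xy∙z≈xz∙y (d s) P _ ⟩
      d s + reactants (C j) s + P  ≡⟨ cong (_+ P) (step-balance c→d s) ⟩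
      c s + products (C j) s + P   ≡⟨ +-assoc (c s) _ P ⟩
      c s + produced (j ∷ js) s    ∎
      where
      open ≡-Reasoning
      P = produced js s

  balanced-∷ : ∀ {c j d js e} → Step C c j d → Balanced d js e → Balanced c (j ∷ js) e
  balanced-∷ {c} {j} {d} {js} {e} c→d (balanced d⇝e) = balanced λ s → begin
    e s + consumed (j ∷ js) s                 ≡⟨ x∙yz≈xz∙y (e s) (reactants (C j) s) _ ⟩
    e s + consumed js s + reactants (C j) s   ≡⟨ cong (_+ reactants (C j) s) (d⇝e s) ⟩
    d s + produced js s + reactants (C j) s   ≡⟨ step-then-rest c→d js s ⟩
    c s + produced (j ∷ js) s                 ∎
    where open ≡-Reasoning

  balanced-∷⁻¹ : ∀ {c j d js e} → Step C c j d → Balanced c (j ∷ js) e → Balanced d js e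
  balanced-∷⁻¹ {c} {j} {d} {js} {e} c→d (balanced c⇝e) = balanced λ s →
    +-cancelʳ-≡ (reactants (C j) s) _ _ (begin
    e s + consumed js s + reactants (C j) s   ≡⟨ x∙yz≈xz∙y (e s) (reactants (C j) s) _ ⟨
    e s + consumed (j ∷ js) s                 ≡⟨ c⇝e s ⟩
    c s + produced (j ∷ js) s                 ≡⟨ step-then-rest c→d js s ⟨
    d s + produced js s + reactants (C j) s   ∎)
    where open ≡-Reasoning

  exec⇒balanced : ∀ {c js d} → Exec C c js d → Balanced c js d
  exec⇒balanced done                  = balanced λ _ → refl
  exec⇒balanced (step {d = d} c→d d→e) = balanced-∷ {d = d} c→d (exec⇒balanced d→e)

  balanced-↭ : ∀ {c js ks d} → js ↭ ks → Balanced c js d → Balanced c ks d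
  balanced-↭ {c} {js} {ks} {d} js↭ks (balanced c⇝d) = balanced λ s →
    trans (cong (d s +_) (sym (total (λ j → reactants (C j) s))))
      (trans (c⇝d s) (cong (c s +_) (total (λ j → products (C j) s))))
    where
    total : ∀ g → sum (map g js) ≡ sum (map g ks)
    total g = sum-↭ (map⁺ g js↭ks)

  balanced-resp-≋ : ∀ {c c′ js d} → c ≋ c′ → Balanced c js d → Balanced c′ js d
  balanced-resp-≋ {js = js} c≋c′ (balanced c⇝d) =
    balanced λ s → trans (c⇝d s) (cong (_+ produced js s) (c≋c′ s))

  balanced-functional : ∀ {c js d d′} → Balanced c js d → Balanced c js d′ → d ≋ d′
  balanced-functional {js = js} (balanced c⇝d) (balanced c⇝d′) s =
    +-cancelʳ-≡ (consumed js s) _ _ (trans (c⇝d s) (sym (c⇝d′ s)))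

  execSegment : (f : ℕ → Config m) → (∀ t → ∃ λ j → Step C (f t) j (f (suc t))) →
    ∀ t u → ∃ λ js → length js ≡ t × Exec C (f u) js (f (t + u))
  execSegment f steps zero    u = [] , refl , done
  execSegment f steps (suc t) u
    with j , fu→ ← steps u
    with js , refl , ex ← execSegment f steps t (suc u)
    = j ∷ js , refl , step fu→ (subst (Exec C (f (suc u)) js ∘ f) (+-suc t u) ex)

  ReactantsUnshared : Set
  ReactantsUnshared = ∀ {s j k} → IsReactant (C j) s → IsReactant (C k) s → j ≡ k

  feedforward⇒reactantsUnshared : ReactionFeedforward C → ReactantsUnshared
  feedforward⇒reactantsUnshared (π , feedforward) {s} {j} {k} rj rk = begin
    j                   ≡⟨ inverseʳ π ⟨
    π ⟨$⟩ʳ (π ⟨$⟩ˡ j)   ≡⟨ cong (π ⟨$⟩ʳ_) (samePosition (atPosition rj) (atPosition rk)) ⟩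
    π ⟨$⟩ʳ (π ⟨$⟩ˡ k)   ≡⟨ inverseʳ π ⟩
    k                   ∎
    where
    open ≡-Reasoning
    atPosition : ∀ {j} → IsReactant (C j) s → IsReactant (C (π ⟨$⟩ʳ (π ⟨$⟩ˡ j))) s
    atPosition = subst (λ j → IsReactant (C j) s) (sym (inverseʳ π))
    samePosition : ∀ {a b} → IsReactant (C (π ⟨$⟩ʳ a)) s → IsReactant (C (π ⟨$⟩ʳ b)) s → a ≡ b
    samePosition {a} {b} ra rb with <-cmp a b
    ... | tri< a<b _ _ = ⊥-elim (feedforward a b a<b s ra (inj₁ rb))
    ... | tri≈ _ a≡b _ = a≡b
    ... | tri> _ _ b<a = ⊥-elim (feedforward b a b<a s rb (inj₁ ra))

  module Unshared (unshared : ReactantsUnshared) where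

    consumed-∉ : ∀ {k s} js → IsReactant (C k) s → k ∉ js → consumed js s ≡ 0
    consumed-∉ []       _  _   = refl
    consumed-∉ (j ∷ js) rk k∉ = cong₂ _+_
      (n≤0⇒n≡0 (≮⇒≥ (λ rj → k∉ (here (unshared rk rj)))))
      (consumed-∉ js rk (k∉ ∘ there))

    applicable⇒pending : ∀ {f rest c k} → Balanced f rest c → Terminal C c →
      Applicable (C k) f → k ∈ rest
    applicable⇒pending {f} {rest} {c} {k} (balanced f⇝c) c-terminal k-applicable with k ∈? rest
    ... | yes k∈rest = k∈rest
    ... | no  k∉rest = ⊥-elim (c-terminal k k-applicable-at-c)
      where
      k-applicable-at-c : Applicable (C k) c
      k-applicable-at-c s with 0 <ℕ? reactants (C k) s
      ... | no  ¬rk = ≤-trans (≮⇒≥ ¬rk) z≤n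
      ... | yes rk  = ≤-trans (k-applicable s) (≤-trans (m≤m+n (f s) _) (≤-reflexive (begin
        f s + produced rest s   ≡⟨ f⇝c s ⟨
        c s + consumed rest s   ≡⟨ cong (c s +_) (consumed-∉ rest rk k∉rest) ⟩
        c s + 0                 ≡⟨ +-identityʳ (c s) ⟩
        c s                     ∎)))
        where open ≡-Reasoning

    terminal-dominates : ∀ {f rest c js d} → Terminal C c → Balanced f rest c →
      Exec C f js d → js ⊑ rest
    terminal-dominates {rest = rest} _ _ done = rest , ↭-refl
    terminal-dominates c-terminal f⇝c (step {d = f′} {j = k} f→f′ f′→d)
      with rest₀ , rest↭k∷rest₀ ← ∈⇒↭∷ (applicable⇒pending f⇝c c-terminal (proj₁ f→f′))
      with rest′ , rest₀↭js++rest′ ← terminal-dominates c-terminal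
             (balanced-∷⁻¹ {d = f′} f→f′ (balanced-↭ rest↭k∷rest₀ f⇝c)) f′→d
      = rest′ , ↭-trans rest↭k∷rest₀ (prep k rest₀↭js++rest′)

    long-execs-reach-terminal : ∀ {i es c js d} → Balanced i es c → Terminal C c →
      Exec C i js d → length es ≤ length js → d ≋ c
    long-execs-reach-terminal {es = es} {js = js} i⇝c c-terminal i→d es≤js =
      balanced-functional (exec⇒balanced i→d) (balanced-↭ es↭js i⇝c)
      where
      es↭js : es ↭ js
      es↭js = ⊑∧length≤⇒↭ (terminal-dominates c-terminal i⇝c i→d) es≤js

    terminal-reachable⇒¬infiniteExec : ∀ {i es c} → Balanced i es c → Terminal C c →
      ¬ InfiniteExec C i
    terminal-reachable⇒¬infiniteExec {es = es} {c} i⇝c c-terminal (f , f0≋i , steps)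
      with j , fL→ ← steps (length es + 0)
      with js , |js|≡|es| , f0→fL ← execSegment f steps (length es) 0
      = c-terminal j (applicable-resp-≋ {ρ = C j} fL≋c (proj₁ fL→))
      where
      fL≋c : f (length es + 0) ≋ c
      fL≋c = long-execs-reach-terminal (balanced-resp-≋ (sym ∘ f0≋i) i⇝c)
        c-terminal f0→fL (≤-reflexive (sym |js|≡|es|))

mainTheorem17 : ∀ {m n} (C : CRN m n) → DistinctReactions C → ReactionFeedforward C →
    (i c : Config m) → Reachable C i c → Terminal C c →
    (∃ λ L → ∀ (js : List (Fin n)) (d : Config m) → Exec C i js d → L ≤ length js → d ≋ c)
    × (∀ (d : Config m) → Reachable C i d → Terminal C d → d ≋ c)
    × (∀ (js ks : List (Fin n)) (d d′ : Config m) → d ≋ c → d′ ≋ c →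
         Exec C i js d → Exec C i ks d′ → js ↭ ks)
    × ¬ InfiniteExec C i
mainTheorem17 C _ feedforward i c (es , i→c) c-terminal =
    (length es , λ _ _ i→d → long-execs-reach-terminal i⇝c c-terminal i→d)
  , (λ _ (_ , i→d) d-terminal → long-execs-reach-terminal i⇝c c-terminal i→d
       (⊑-length (terminal-dominates d-terminal (exec⇒balanced i→d) i→c)))
  , (λ _ _ _ _ d≋c d′≋c i→d i→d′ → ⊑-antisym
       (terminal-dominates (terminal-resp-≋ {C = C} d′≋c c-terminal) (exec⇒balanced i→d′) i→d)
       (terminal-dominates (terminal-resp-≋ {C = C} d≋c c-terminal) (exec⇒balanced i→d) i→d′))
  , terminal-reachable⇒¬infiniteExec i⇝c c-terminal
  where
  open Executions C
  open Unshared (feedforward⇒reactantsUnshared feedforward)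
  i⇝c : Balanced i es c
  i⇝c = exec⇒balanced i→c
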